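{- There does not exist a tree on $2$ or more vertices in which every path joining a pair of leaves contains $2$ or more vertices of degree at least $3$. -}

module Defs where

open import Data.Nat using (ℕ; zero; suc; _≤_; _≤?_)
open import Data.Bool using (Bool; true; false; if_then_else_)
open import Data.Fin using (Fin)
open import Data.List using (List; []; _∷_; length; filter; map; allFin)
open import Data.Nat.ListAction using (sum)
open import Data.List.Relation.Unary.Unique.Propositional using (Unique)
open import Data.Product using (_×_; Σ; ∃)
open import Relation.Binary.PropositionalEquality using (_≡_; _≢_)
open import Relation.Nullary using (¬_)

record Graph (n : ℕ) : Set where
  field
    adj   : Fin n → Fin n → Bool
    sym   : ∀ u v → adj u v ≡ adj v u
    irrfl : ∀ v → adj v v ≡ false
open Graph public

module _ {n : ℕ} (G : Graph n) where

  degree : Fin n → ℕ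
  degree v = sum (map (λ w → if adj G v w then 1 else 0) (allFin n))

  IsLeaf : Fin n → Set
  IsLeaf v = degree v ≡ 1

  data Walk : Fin n → Fin n → Set where
    [_]  : (v : Fin n) → Walk v v
    step : (u : Fin n) {w v : Fin n} → adj G u w ≡ true → Walk w v → Walk u v

  vertices : ∀ {u v} → Walk u v → List (Fin n)
  vertices [ v ]          = v ∷ []
  vertices (step u _ p)   = u ∷ vertices p

  IsPath : ∀ {u v} → Walk u v → Set
  IsPath p = Unique (vertices p)

  HasCycle : Set
  HasCycle = Σ (Fin n) λ u → Σ (Fin n) λ v → Σ (Walk u v) λ p →
               IsPath p × (3 ≤ length (vertices p)) × (adj G v u ≡ true)

  Connected : Set
  Connected = ∀ u v → Walk u v

  IsTree : Set
  IsTree = Connected × ¬ HasCycle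

  highDegreeCount : ∀ {u v} → Walk u v → ℕ
  highDegreeCount p = length (filter (λ w → 3 ≤? degree w) (vertices p))

-- Call a vertex high if its degree is at least 3 and low otherwise, and call a
-- non-backtracking walk p, z, …, ℓ a low ray from p through z if it ends at a leaf ℓ and
-- all its vertices after p are low. In a tree non-backtracking walks are paths, so they
-- have at most n vertices, and induction along them shows that every directed edge
-- p → z carries a low ray: a leaf z is one, a low z of degree 2 passes on to its other
-- neighbour, and a high z cannot occur, because two low rays leaving z through distinct
-- neighbours join into a leaf-to-leaf path whose only high vertex is z. The low rays
-- along the two directions of any edge then join into a leaf-to-leaf path with no high
-- vertex at all.

module Submission where

open import Defs hiding (sym)
open import Data.Nat using (ℕ; zero; suc; _+_; _≤_; _<_; z≤n; s≤s; _≤?_; _≟_)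
open import Data.Nat.Properties using (≤-trans; ≤-reflexive; ≤∧≢⇒<; +-suc; <⇒≱; m<m+n)
open import Data.Fin using (Fin; zero; suc) renaming (_≟_ to _≟ᶠ_)
open import Data.Bool using (Bool; true; false; if_then_else_)
open import Data.Bool.Properties using () renaming (_≟_ to _≟ᵇ_)
open import Data.List using (List; []; _∷_; _++_; _ʳ++_; length; filter; map; allFin)
open import Data.List.Properties
  using (length-++-sucʳ; length-tabulate; filter-accept; filter-reject; filter-none)
open import Data.Nat.ListAction using (sum)
open import Data.List.Relation.Unary.All as All using (All; []; _∷_)
open import Data.List.Relation.Unary.All.Properties using (¬Any⇒All¬; ¬All⇒Any¬; ++⁻ˡ)
open import Data.List.Relation.Unary.Any using (here; there)
open import Data.List.Relation.Unary.AllPairs as AllPairs using ([]; _∷_)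
open import Data.List.Relation.Unary.Unique.Propositional using (Unique)
open import Data.List.Relation.Unary.Unique.Propositional.Properties using (filter⁺; allFin⁺)
open import Data.List.Membership.Propositional using (_∈_; _∉_; find)
open import Data.List.Membership.Propositional.Properties
  using (∈-∃++; ∈-++⁻; ∈-++⁺ˡ; ∈-++⁺ʳ; ∈-allFin; ∈-filter⁺; ∈-filter⁻; ∈-length)
import Data.List.Membership.DecPropositional as DecMembership
open import Data.List.Relation.Binary.Subset.Propositional using (_⊆_)
open import Data.Product using (_×_; _,_; proj₂; Σ; ∃; ∃₂)
open import Data.Sum using (inj₁; inj₂)
open import Data.Unit using (⊤; tt)
open import Data.Empty using (⊥; ⊥-elim)
open import Function using (_∘_)
open import Relation.Binary.Definitions using (DecidableEquality)
open import Relation.Binary.PropositionalEquality using (_≡_; _≢_; refl; sym; trans; cong; subst)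
open import Relation.Nullary using (¬_; Dec; yes; no; contradiction)

module _ {A : Set} where

  lastOf : A → List A → A
  lastOf x []       = x
  lastOf x (y ∷ ys) = lastOf y ys

  lastOf-∈ : ∀ x ys → lastOf x ys ∈ x ∷ ys
  lastOf-∈ x []       = here refl
  lastOf-∈ x (y ∷ ys) = there (lastOf-∈ y ys)

  ʳ++-ends : ∀ xs a b ys → ∃₂ λ b′ zs →
             xs ʳ++ (a ∷ b ∷ ys) ≡ lastOf a xs ∷ b′ ∷ zs × lastOf b′ zs ≡ lastOf b ys
  ʳ++-ends []       a b ys = b , ys , refl , refl
  ʳ++-ends (x ∷ xs) a b ys = ʳ++-ends xs x a (b ∷ ys)

  unique-∷-prefix : ∀ {x : A} xs {ys} → Unique (xs ++ x ∷ ys) → Unique (x ∷ xs)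
  unique-∷-prefix []       _           = [] ∷ []
  unique-∷-prefix (y ∷ xs) (y∉ ∷ uniq) with x∉xs ∷ uniqxs ← unique-∷-prefix xs uniq =
    (x≢y ∷ x∉xs) ∷ ++⁻ˡ xs y∉ ∷ uniqxs
    where
    x≢y = λ x≡y → All.lookup y∉ (∈-++⁺ʳ xs (here refl)) (sym x≡y)

  ⊆-length : ∀ {xs ys : List A} → Unique xs → xs ⊆ ys → length xs ≤ length ys
  ⊆-length []            _ = z≤n
  ⊆-length {x ∷ xs} (x∉xs ∷ uniq) xs⊆ys
    with ys₁ , ys₂ , refl ← ∈-∃++ (xs⊆ys (here refl)) =
    ≤-trans (s≤s (⊆-length uniq xs⊆ys₁++ys₂)) (≤-reflexive (sym (length-++-sucʳ ys₁ x ys₂)))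
    where
    xs⊆ys₁++ys₂ : xs ⊆ ys₁ ++ ys₂
    xs⊆ys₁++ys₂ y∈xs with ∈-++⁻ ys₁ (xs⊆ys (there y∈xs))
    ... | inj₁ y∈ys₁         = ∈-++⁺ˡ y∈ys₁
    ... | inj₂ (here y≡x)    = contradiction (sym y≡x) (All.lookup x∉xs y∈xs)
    ... | inj₂ (there y∈ys₂) = ∈-++⁺ʳ ys₁ y∈ys₂

  module _ (_≟_ : DecidableEquality A) where
    open DecMembership _≟_ using (_∈?_)

    unique-longer⇒∃∉ : ∀ {xs ys} → Unique xs → length ys < length xs →
                       ∃ λ x → x ∈ xs × x ∉ ys
    unique-longer⇒∃∉ {xs} {ys} uniq longer with All.all? (_∈? ys) xs
    ... | yes xs⊆ys = contradiction (⊆-length uniq (All.lookup xs⊆ys)) (<⇒≱ longer)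
    ... | no  xs⊈ys = find (¬All⇒Any¬ (_∈? ys) xs xs⊈ys)

  sum-indicator≡length-filter : ∀ (f : A → Bool) xs →
    sum (map (λ x → if f x then 1 else 0) xs) ≡ length (filter (λ x → f x ≟ᵇ true) xs)
  sum-indicator≡length-filter f []       = refl
  sum-indicator≡length-filter f (x ∷ xs) with f x
  ... | true  = cong suc (sum-indicator≡length-filter f xs)
  ... | false = sum-indicator≡length-filter f xs

unique⇒length≤ : ∀ {n} {xs : List (Fin n)} → Unique xs → length xs ≤ n
unique⇒length≤ {n} uniq =
  ≤-trans (⊆-length uniq (λ {x} _ → ∈-allFin x)) (≤-reflexive (length-tabulate (λ i → i)))

module _ {n : ℕ} (G : Graph n) where

  Adjacent : Fin n → Fin n → Set
  Adjacent u v = adj G u v ≡ true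

  adjacent-sym : ∀ {u v} → Adjacent u v → Adjacent v u
  adjacent-sym {u} {v} = trans (Graph.sym G v u)

  adjacent? : ∀ v w → Dec (Adjacent v w)
  adjacent? v w = adj G v w ≟ᵇ true

  neighbours : Fin n → List (Fin n)
  neighbours v = filter (adjacent? v) (allFin n)

  degree≡length-neighbours : ∀ v → degree G v ≡ length (neighbours v)
  degree≡length-neighbours v = sum-indicator≡length-filter (adj G v) (allFin n)

  adjacent⇒degree>0 : ∀ {v w} → Adjacent v w → 0 < degree G v
  adjacent⇒degree>0 {v} {w} v~w = subst (0 <_) (sym (degree≡length-neighbours v))
                                         (∈-length (∈-filter⁺ (adjacent? v) (∈-allFin w) v~w))

  fresh-neighbour : ∀ v xs → length xs < degree G v → ∃ λ w → Adjacent v w × w ∉ xs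
  fresh-neighbour v xs short
    with w , w∈ , w∉ ← unique-longer⇒∃∉ _≟ᶠ_ (filter⁺ (adjacent? v) (allFin⁺ n))
                         (subst (length xs <_) (degree≡length-neighbours v) short)
    = w , proj₂ (∈-filter⁻ (adjacent? v) {xs = allFin n} w∈) , w∉

  High Low : Fin n → Set
  High v = 3 ≤ degree G v
  Low  v = ¬ High v

  high? : ∀ v → Dec (High v)
  high? v = 3 ≤? degree G v

  leaf⇒low : ∀ {v} → IsLeaf G v → Low v
  leaf⇒low leaf high with s≤s () ← subst (3 ≤_) leaf high

  highCount : List (Fin n) → ℕ
  highCount xs = length (filter high? xs)

  highCount-ʳ++-low : ∀ {xs} ys → All Low xs → highCount (xs ʳ++ ys) ≡ highCount ys
  highCount-ʳ++-low ys []                  = refl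
  highCount-ʳ++-low ys (_∷_ {x} low lows) =
    trans (highCount-ʳ++-low (x ∷ ys) lows) (cong length (filter-reject high? low))

  highCount-∷-low : ∀ x {xs} → All Low xs → highCount (x ∷ xs) ≤ 1
  highCount-∷-low x {xs} lows with high? x
  ... | yes high = ≤-reflexive (trans (cong length (filter-accept high? high))
                                      (cong (suc ∘ length) (filter-none high? lows)))
  ... | no  low  = ≤-trans (≤-reflexive (trans (cong length (filter-reject high? low))
                                               (cong length (filter-none high? lows)))) z≤n

  NonBacktrackingWalk : List (Fin n) → Set
  NonBacktrackingWalk []               = ⊤
  NonBacktrackingWalk (_ ∷ [])         = ⊤
  NonBacktrackingWalk (x ∷ y ∷ [])     = Adjacent x y
  NonBacktrackingWalk (x ∷ y ∷ z ∷ zs) = Adjacent x y × x ≢ z × NonBacktrackingWalk (y ∷ z ∷ zs)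

  nb-head : ∀ {x y zs} → NonBacktrackingWalk (x ∷ y ∷ zs) → Adjacent x y
  nb-head {zs = []}    x~y       = x~y
  nb-head {zs = _ ∷ _} (x~y , _) = x~y

  nb-tail : ∀ {x xs} → NonBacktrackingWalk (x ∷ xs) → NonBacktrackingWalk xs
  nb-tail {xs = []}        _           = tt
  nb-tail {xs = _ ∷ []}    _           = tt
  nb-tail {xs = _ ∷ _ ∷ _} (_ , _ , nb) = nb

  nb-++⁻ˡ : ∀ xs {ys} → NonBacktrackingWalk (xs ++ ys) → NonBacktrackingWalk xs
  nb-++⁻ˡ []               _                = tt
  nb-++⁻ˡ (_ ∷ [])         _                = tt
  nb-++⁻ˡ (_ ∷ _ ∷ [])     nb               = nb-head nb
  nb-++⁻ˡ (_ ∷ y ∷ z ∷ xs) (x~y , x≢z , nb) = x~y , x≢z , nb-++⁻ˡ (y ∷ z ∷ xs) nb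

  nb-lastOf-adjacent : ∀ {x} ys {z zs} → NonBacktrackingWalk (x ∷ ys ++ z ∷ zs) →
                       Adjacent (lastOf x ys) z
  nb-lastOf-adjacent []       nb = nb-head nb
  nb-lastOf-adjacent (_ ∷ ys) nb = nb-lastOf-adjacent ys (nb-tail nb)

  nb-ʳ++ : ∀ {m a} xs {ys} → NonBacktrackingWalk (m ∷ a ∷ xs) →
           NonBacktrackingWalk (a ∷ m ∷ ys) → NonBacktrackingWalk (xs ʳ++ (a ∷ m ∷ ys))
  nb-ʳ++ []       _               nb₂ = nb₂
  nb-ʳ++ (_ ∷ xs) (_ , m≢x , nb₁) nb₂ =
    nb-ʳ++ xs nb₁ (adjacent-sym (nb-head nb₁) , m≢x ∘ sym , nb₂)

  walkOf : ∀ x xs → NonBacktrackingWalk (x ∷ xs) → Walk G x (lastOf x xs)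
  walkOf x []       _  = [ x ]
  walkOf x (y ∷ ys) nb = step x (nb-head nb) (walkOf y ys (nb-tail nb))

  vertices-walkOf : ∀ x xs nb → vertices G (walkOf x xs nb) ≡ x ∷ xs
  vertices-walkOf x []       _  = refl
  vertices-walkOf x (y ∷ ys) nb = cong (x ∷_) (vertices-walkOf y ys (nb-tail nb))

  module _ (acyclic : ¬ HasCycle G) where

    nb-no-revisit : ∀ {x} pre {post} → NonBacktrackingWalk (x ∷ pre ++ x ∷ post) →
                    Unique (pre ++ x ∷ post) → ⊥
    nb-no-revisit {x} [] nb _ with () ← trans (sym (nb-head nb)) (irrfl G x)
    nb-no-revisit (_ ∷ []) (_ , x≢x , _) _ = x≢x refl
    nb-no-revisit {x} cycle@(_ ∷ _ ∷ _) nb uniq =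
      acyclic (x , lastOf x cycle , walkOf x cycle nb-cycle ,
               subst Unique (sym vertices≡) (unique-∷-prefix cycle uniq) ,
               subst (λ vs → 3 ≤ length vs) (sym vertices≡) (s≤s (s≤s (s≤s z≤n))) ,
               nb-lastOf-adjacent cycle nb)
      where
      nb-cycle = nb-++⁻ˡ (x ∷ cycle) nb
      vertices≡ = vertices-walkOf x cycle nb-cycle

    nb⇒unique : ∀ {xs} → NonBacktrackingWalk xs → Unique xs
    nb⇒unique {[]}     _  = []
    nb⇒unique {x ∷ xs} nb = ¬Any⇒All¬ xs x∉xs ∷ uniq
      where
      uniq = nb⇒unique (nb-tail nb)
      x∉xs : x ∉ xs
      x∉xs x∈xs with pre , post , xs≡ ← ∈-∃++ x∈xs =
        nb-no-revisit pre (subst (NonBacktrackingWalk ∘ (x ∷_)) xs≡ nb) (subst Unique xs≡ uniq)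

  record LowRay (p z : Fin n) : Set where
    field
      beyond          : List (Fin n)
      nonBacktracking : NonBacktrackingWalk (p ∷ z ∷ beyond)
      low             : All Low (z ∷ beyond)
      leafEnd         : IsLeaf G (lastOf z beyond)
  open LowRay

  leaf-ray : ∀ {p z} → Adjacent p z → IsLeaf G z → LowRay p z
  leaf-ray p~z leaf = record
    { beyond = [] ; nonBacktracking = p~z ; low = leaf⇒low leaf ∷ [] ; leafEnd = leaf }

  ray-∷ : ∀ {p z y} → Adjacent p z → p ≢ y → Low z → LowRay z y → LowRay p z
  ray-∷ p~z p≢y lowᶻ ray = record
    { beyond          = _ ∷ beyond ray
    ; nonBacktracking = p~z , p≢y , nonBacktracking ray
    ; low             = lowᶻ ∷ low ray
    ; leafEnd         = leafEnd ray
    }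

  module _ (acyclic : ¬ HasCycle G)
           (leaf-paths-high : ∀ u v → IsLeaf G u → IsLeaf G v → u ≢ v →
                              (p : Walk G u v) → IsPath G p → 2 ≤ highDegreeCount G p) where

    no-light-leaf-path : ∀ u v ws → NonBacktrackingWalk (u ∷ v ∷ ws) →
                         IsLeaf G u → IsLeaf G (lastOf v ws) → highCount (u ∷ v ∷ ws) ≤ 1 → ⊥
    no-light-leaf-path u v ws nb leafᵤ leafᵥ light =
      contradiction (≤-trans two-high (subst (λ vs → highCount vs ≤ 1) (sym vertices≡) light))
                    λ { (s≤s ()) }
      where
      uniq      = nb⇒unique acyclic nb
      u≢end     = All.lookup (AllPairs.head uniq) (lastOf-∈ v ws)
      path      = walkOf u (v ∷ ws) nb
      vertices≡ = vertices-walkOf u (v ∷ ws) nb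
      two-high  = leaf-paths-high u (lastOf v ws) leafᵤ leafᵥ u≢end path
                                  (subst Unique (sym vertices≡) uniq)

    no-opposite-low-walks : ∀ {m a ys} → LowRay m a → NonBacktrackingWalk (a ∷ m ∷ ys) →
                        All Low ys → IsLeaf G (lastOf m ys) → ⊥
    no-opposite-low-walks {m} {a} {ys} ray nb lows leaf
      with b , zs , joined≡ , lastOf≡ ← ʳ++-ends (beyond ray) a m ys =
      no-light-leaf-path _ b zs
        (subst NonBacktrackingWalk joined≡ (nb-ʳ++ (beyond ray) (nonBacktracking ray) nb))
        (leafEnd ray) (subst (IsLeaf G) (sym lastOf≡) leaf)
        (subst (λ vs → highCount vs ≤ 1) joined≡ light)
      where
      light : highCount ((a ∷ beyond ray) ʳ++ (m ∷ ys)) ≤ 1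
      light = ≤-trans (≤-reflexive (highCount-ʳ++-low (m ∷ ys) (low ray)))
                      (highCount-∷-low m lows)

    no-distinct-low-rays : ∀ {z b c} → b ≢ c → LowRay z b → LowRay z c → ⊥
    no-distinct-low-rays b≢c rayᵇ rayᶜ =
      no-opposite-low-walks rayᵇ
        (adjacent-sym (nb-head (nonBacktracking rayᵇ)) , b≢c , nonBacktracking rayᶜ)
        (low rayᶜ) (leafEnd rayᶜ)

    low-ray : ∀ k {z p} R → NonBacktrackingWalk (z ∷ p ∷ R) → n < k + length (z ∷ p ∷ R) →
              LowRay p z
    low-ray zero            R nb long =
      contradiction (unique⇒length≤ (nb⇒unique acyclic nb)) (<⇒≱ long)
    low-ray (suc k) {z} {p} R nb long = classify (degree G z ≟ 1) (high? z)
      where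
      p~z = adjacent-sym (nb-head nb)

      ray-via : ∀ {y} → Adjacent z y → y ≢ p → LowRay z y
      ray-via z~y y≢p =
        low-ray k (p ∷ R) (adjacent-sym z~y , y≢p , nb) (subst (n <_) (sym (+-suc k _)) long)

      classify : Dec (IsLeaf G z) → Dec (High z) → LowRay p z
      classify (yes leaf) _ = leaf-ray p~z leaf
      classify (no _) (yes high)
        with b , z~b , b∉ ← fresh-neighbour z (p ∷ []) (≤-trans (s≤s (s≤s z≤n)) high)
        with c , z~c , c∉ ← fresh-neighbour z (p ∷ b ∷ []) high
        = ⊥-elim (no-distinct-low-rays (λ b≡c → c∉ (there (here (sym b≡c))))
                                    (ray-via z~b (b∉ ∘ here)) (ray-via z~c (c∉ ∘ here)))
      classify (no ¬leaf) (no lowᶻ)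
        with y , z~y , y∉ ← fresh-neighbour z (p ∷ [])
                              (≤∧≢⇒< (adjacent⇒degree>0 (nb-head nb)) (¬leaf ∘ sym))
        = ray-∷ p~z (y∉ ∘ here ∘ sym) lowᶻ (ray-via z~y (y∉ ∘ here))

    no-edge : ∀ {x w} → Adjacent x w → ⊥
    no-edge x~w =
      no-opposite-low-walks forward (nonBacktracking backward) (All.tail (low backward))
                            (leafEnd backward)
      where
      long     = m<m+n n (s≤s z≤n)
      forward  = low-ray n [] (adjacent-sym x~w) long
      backward = low-ray n [] x~w long

lemma3p9 : ¬ (Σ ℕ λ n → Σ (Graph n) λ G → 2 ≤ n × IsTree G ×
               (∀ (u v : Fin n) → IsLeaf G u → IsLeaf G v → u ≢ v →
                  (p : Walk G u v) → IsPath G p → 2 ≤ highDegreeCount G p))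
lemma3p9 (zero        , _ , ()     , _)
lemma3p9 (suc zero    , _ , s≤s () , _)
lemma3p9 (suc (suc _) , G , _      , (connected , acyclic) , leaf-paths-high)
  with step _ 0~w _ ← connected zero (suc zero) = no-edge G acyclic leaf-paths-high 0~w
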